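{- Let $(0,0)$ be the beginning board for an Empty Board $F_3$ Black Hole Zeckendorf game with $n$ pieces. Player $1$ has a constructive strategy for winning for any $n \equiv 1,2,3,6,8 \pmod 9$. Player $2$ has a constructive strategy for winning for any $n \equiv 0,4,5,7 \pmod 9$.
   Context: Fibonacci numbers are indexed so that $F_1=1$, $F_2=2$, $F_{k+1}=F_k+F_{k-1}$. The Empty Board $F_3$ Black Hole Zeckendorf game is played on a board with two columns $F_1$ and $F_2$ (weights $1$ and $2$); a board state $(a,b)$ means $a$ pieces in column $F_1$ and $b$ pieces in column $F_2$. The game starts from the empty board $(0,0)$ and a positive integer $n$. Placement phase: players alternate (Player $1$ first), each placing one piece in column $F_1$ or $F_2$; placing in column $F_i$ uses up $F_i$ of the remaining value, and is only allowed if $F_i$ is at most the remaining value; this phase ends when the weighted sum of the board equals $n$. The last player to place a piece moves second in the decomposition phase. Decomposition phase: players alternate choosing among the moves: Add (remove one piece from each of $F_i$ and $F_{i+1}$ and place one piece on $F_{i+2}$), Merge (remove two pieces from $F_1$ and place one on $F_2$), Split (remove two pieces from $F_2$ and place one on $F_1$ and one on $F_3$; for $i\ge 3$, two pieces from $F_i$ to one on $F_{i-2}$ and one on $F_{i+1}$). Any piece that would be placed on column $F_3$ (or beyond) falls into the ``black hole'' and is permanently removed from play. The last player to move wins (normal play). -}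

module Defs where

open import Data.Nat using (ℕ; zero; suc)

-- A game position: remaining value r to be placed, and board (a , b) with
-- a pieces in column F₁ (weight 1) and b pieces in column F₂ (weight 2).
-- r > 0 : placement phase;  r = 0 : decomposition phase.
-- Column F₃ and beyond is the black hole: pieces sent there vanish.
data Pos : Set where
  pos : (r a b : ℕ) → Pos

data _⇒_ : Pos → Pos → Set where
  put₁  : ∀ {r a b} → pos (suc r) a b ⇒ pos r (suc a) b
  put₂  : ∀ {r a b} → pos (suc (suc r)) a b ⇒ pos r a (suc b)
  -- decomposition phase
  -- Add on F₁,F₂: one piece from each, new piece on F₃ falls into the black hole
  add   : ∀ {a b} → pos 0 (suc a) (suc b) ⇒ pos 0 a b
  merge : ∀ {a b} → pos 0 (suc (suc a)) b ⇒ pos 0 a (suc b)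
  -- Split on F₂: two pieces to one on F₁ and one on F₃ (black hole)
  split : ∀ {a b} → pos 0 a (suc (suc b)) ⇒ pos 0 (suc a) b

-- Constructive winning strategies (normal play: last player to move wins).
data Win : Pos → Set
data Lose : Pos → Set

data Win where
  win : ∀ {p q} → p ⇒ q → Lose q → Win p

data Lose where
  lose : ∀ {p} → (∀ {q} → p ⇒ q → Win q) → Lose p

start : ℕ → Pos
start n = pos n 0 0

{-# OPTIONS --safe #-}
module Submission where

-- Every piece falling into the black hole carries the value F₃ = 3, so the total value (value still
-- to place plus value on the board) is invariant mod 3, and it determines the board (0,0), (1,0) or
-- (0,1) on which the decomposition ends.  Placements add one piece and decomposition moves remove one
-- or two, so a position is described by the value r still to place and the surplus g ∈ ℤ/3 of its
-- pieces over that final board: placing moves (r, g) to (r − 1, g + 1) or (r − 2, g + 1), and once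
-- r = 0 the player to move wins iff g ≢ 0.  The one subtlety is that a decomposition move removing the
-- right number of pieces must exist; it does, because g ≢ 2 whenever a column is empty.  The losing
-- positions of this reduced game, computed by recursion on r, are 9-periodic in r.

open import Defs
open import Data.Bool using (Bool; true; false; not; _∨_)
open import Data.Bool.Properties using (not-injective; ∨-conicalˡ; ∨-conicalʳ)
open import Data.Empty using (⊥-elim)
open import Data.Nat using (ℕ; zero; suc; _+_; _*_; _/_; _%_; _≤_; _<_; NonZero)
open import Data.Nat.DivMod using (m≡m%n+[m/n]*n)
open import Data.Nat.Induction using (<-wellFounded)
open import Data.Nat.Properties using (+-assoc; +-comm; +-suc; m≤n+m)
open import Data.Nat.Tactic.RingSolver using (solve-∀)
open import Data.Product using (_×_; _,_; proj₁; proj₂; ∃-syntax)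
open import Data.Sum using (_⊎_; inj₁; inj₂)
open import Function using (_∘_)
open import Induction.WellFounded using (Acc; acc; WellFounded; module Subrelation)
open import Relation.Binary.Construct.On as On using ()
open import Relation.Binary.PropositionalEquality
  using (_≡_; _≢_; refl; sym; trans; cong; cong₂; subst; module ≡-Reasoning)
open ≡-Reasoning

_⇐_ : Pos → Pos → Set
q ⇐ p = p ⇒ q

weight : Pos → ℕ
weight (pos r a b) = a + b + 2 * r

n≡k+1+m⇒m<n : ∀ {m n} k → n ≡ k + (1 + m) → m < n
n≡k+1+m⇒m<n {m} k n≡ = subst (suc m ≤_) (sym n≡) (m≤n+m (suc m) k)

weight-⇒ : ∀ {p q} → p ⇒ q → weight q < weight p
weight-⇒ (put₁ {r} {a} {b}) = n≡k+1+m⇒m<n 0 (put₁-gap r a b)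
  where
  put₁-gap : ∀ r a b → a + b + 2 * suc r ≡ 0 + suc (suc a + b + 2 * r)
  put₁-gap = solve-∀
weight-⇒ (put₂ {r} {a} {b}) = n≡k+1+m⇒m<n 2 (put₂-gap r a b)
  where
  put₂-gap : ∀ r a b → a + b + 2 * suc (suc r) ≡ 2 + suc (a + suc b + 2 * r)
  put₂-gap = solve-∀
weight-⇒ (add {a} {b}) = n≡k+1+m⇒m<n 1 (add-gap a b)
  where
  add-gap : ∀ a b → suc a + suc b + 2 * 0 ≡ 1 + suc (a + b + 2 * 0)
  add-gap = solve-∀
weight-⇒ (merge {a} {b}) = n≡k+1+m⇒m<n 0 (merge-gap a b)
  where
  merge-gap : ∀ a b → suc (suc a) + b + 2 * 0 ≡ 0 + suc (a + suc b + 2 * 0)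
  merge-gap = solve-∀
weight-⇒ (split {a} {b}) = n≡k+1+m⇒m<n 0 (split-gap a b)
  where
  split-gap : ∀ a b → a + suc (suc b) + 2 * 0 ≡ 0 + suc (suc a + b + 2 * 0)
  split-gap = solve-∀

⇐-wellFounded : WellFounded _⇐_
⇐-wellFounded = Subrelation.wellFounded weight-⇒ (On.wellFounded weight <-wellFounded)

module Outcomes
  (lost : Pos → Bool)
  (lost-trapped : ∀ {p q} → p ⇒ q → lost p ≡ true → lost q ≡ false)
  (lost-escape : ∀ {p} → lost p ≡ false → ∃[ q ] p ⇒ q × lost q ≡ true)
  where

  private
    outcome : ∀ {p} → Acc _⇐_ p → (lost p ≡ true → Lose p) × (lost p ≡ false → Win p)
    outcome (acc rs) =
        (λ h → lose λ m → proj₂ (outcome (rs m)) (lost-trapped m h))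
      , (λ h → let (_ , m , h′) = lost-escape h in win m (proj₁ (outcome (rs m)) h′))

  lost⇒Lose : ∀ p → lost p ≡ true → Lose p
  lost⇒Lose p = proj₁ (outcome (⇐-wellFounded p))

  ¬lost⇒Win : ∀ p → lost p ≡ false → Win p
  ¬lost⇒Win p = proj₂ (outcome (⇐-wellFounded p))

data ℤ₃ : Set where
  0₃ 1₃ 2₃ : ℤ₃

suc₃ : ℤ₃ → ℤ₃
suc₃ 0₃ = 1₃
suc₃ 1₃ = 2₃
suc₃ 2₃ = 0₃

suc₃-injective : ∀ {x y} → suc₃ x ≡ suc₃ y → x ≡ y
suc₃-injective {0₃} {0₃} refl = refl
suc₃-injective {1₃} {1₃} refl = refl
suc₃-injective {2₃} {2₃} refl = refl

[_]₃ : ℕ → ℤ₃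
[ zero ]₃ = 0₃
[ suc n ]₃ = suc₃ [ n ]₃

[3+n]₃≡[n]₃ : ∀ n → [ 3 + n ]₃ ≡ [ n ]₃
[3+n]₃≡[n]₃ n with [ n ]₃
... | 0₃ = refl
... | 1₃ = refl
... | 2₃ = refl

value : Pos → ℕ
value (pos r a b) = a + 2 * b + r

pieces : Pos → ℕ
pieces (pos _ a b) = a + b

value-⇒ : ∀ {p q} → p ⇒ q → value p ≡ value q ⊎ value p ≡ 3 + value q
value-⇒ (put₁ {r} {a} {b}) = inj₁ (put₁-value r a b)
  where
  put₁-value : ∀ r a b → a + 2 * b + suc r ≡ suc a + 2 * b + r
  put₁-value = solve-∀
value-⇒ (put₂ {r} {a} {b}) = inj₁ (put₂-value r a b)
  where
  put₂-value : ∀ r a b → a + 2 * b + suc (suc r) ≡ a + 2 * suc b + r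
  put₂-value = solve-∀
value-⇒ (add {a} {b}) = inj₂ (add-value a b)
  where
  add-value : ∀ a b → suc a + 2 * suc b + 0 ≡ 3 + (a + 2 * b + 0)
  add-value = solve-∀
value-⇒ (merge {a} {b}) = inj₁ (merge-value a b)
  where
  merge-value : ∀ a b → suc (suc a) + 2 * b + 0 ≡ a + 2 * suc b + 0
  merge-value = solve-∀
value-⇒ (split {a} {b}) = inj₂ (split-value a b)
  where
  split-value : ∀ a b → a + 2 * suc (suc b) + 0 ≡ 3 + (suc a + 2 * b + 0)
  split-value = solve-∀

valueClass-⇒ : ∀ {p q} → p ⇒ q → [ value p ]₃ ≡ [ value q ]₃
valueClass-⇒ {q = q} m with value-⇒ m
... | inj₁ v≡ = cong [_]₃ v≡
... | inj₂ v≡ = trans (cong [_]₃ v≡) ([3+n]₃≡[n]₃ (value q))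

-- The final board of value class v is (0,0), (1,0) or (0,1), holding 0, 1, 1 pieces, so
-- surplus v k is k minus that count (suc₃ ∘ suc₃ subtracts one).
surplus : ℤ₃ → ℤ₃ → ℤ₃
surplus 0₃ k = k
surplus 1₃ k = suc₃ (suc₃ k)
surplus 2₃ k = suc₃ (suc₃ k)

surplus-suc₃ : ∀ v k → surplus v (suc₃ k) ≡ suc₃ (surplus v k)
surplus-suc₃ 0₃ k = refl
surplus-suc₃ 1₃ k = refl
surplus-suc₃ 2₃ k = refl

excess : Pos → ℤ₃
excess p = surplus [ value p ]₃ [ pieces p ]₃

excess-suc : ∀ p q → [ value p ]₃ ≡ [ value q ]₃ → [ pieces p ]₃ ≡ suc₃ [ pieces q ]₃ →
             excess p ≡ suc₃ (excess q)
excess-suc p q v≡ k≡ = trans (cong₂ surplus v≡ k≡) (surplus-suc₃ [ value q ]₃ [ pieces q ]₃)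

excess-put₁ : ∀ r a b → excess (pos r (suc a) b) ≡ suc₃ (excess (pos (suc r) a b))
excess-put₁ r a b =
  excess-suc (pos r (suc a) b) (pos (suc r) a b) (sym (valueClass-⇒ (put₁ {r} {a} {b}))) refl

excess-put₂ : ∀ r a b → excess (pos r a (suc b)) ≡ suc₃ (excess (pos (suc (suc r)) a b))
excess-put₂ r a b = excess-suc (pos r a (suc b)) (pos (suc (suc r)) a b)
  (sym (valueClass-⇒ (put₂ {r} {a} {b}))) (cong [_]₃ (+-suc a b))

excess-merge : ∀ a b → excess (pos 0 (suc (suc a)) b) ≡ suc₃ (excess (pos 0 a (suc b)))
excess-merge a b = excess-suc (pos 0 (suc (suc a)) b) (pos 0 a (suc b))
  (valueClass-⇒ (merge {a} {b})) (cong (suc₃ ∘ [_]₃) (sym (+-suc a b)))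

excess-split : ∀ a b → excess (pos 0 a (suc (suc b))) ≡ suc₃ (excess (pos 0 (suc a) b))
excess-split a b = excess-suc (pos 0 a (suc (suc b))) (pos 0 (suc a) b)
  (valueClass-⇒ (split {a} {b})) (cong [_]₃ (trans (+-suc a (suc b)) (cong suc (+-suc a b))))

excess-add : ∀ a b → excess (pos 0 (suc a) (suc b)) ≡ suc₃ (suc₃ (excess (pos 0 a b)))
excess-add a b = begin
  excess (pos 0 (suc a) (suc b))
    ≡⟨ cong₂ surplus (valueClass-⇒ (add {a} {b})) (cong (suc₃ ∘ [_]₃) (+-suc a b)) ⟩
  surplus v (suc₃ (suc₃ k))  ≡⟨ surplus-suc₃ v (suc₃ k) ⟩
  suc₃ (surplus v (suc₃ k))  ≡⟨ cong suc₃ (surplus-suc₃ v k) ⟩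
  suc₃ (suc₃ (surplus v k))  ∎
  where
  v k : ℤ₃
  v = [ value (pos 0 a b) ]₃
  k = [ a + b ]₃

excess-3+a : ∀ r a b → excess (pos r (3 + a) b) ≡ excess (pos r a b)
excess-3+a r a b = cong₂ surplus ([3+n]₃≡[n]₃ (a + 2 * b + r)) ([3+n]₃≡[n]₃ (a + b))

excess-3+b : ∀ r a b → excess (pos r a (3 + b)) ≡ excess (pos r a b)
excess-3+b r a b = cong₂ surplus
  (begin
    [ a + 2 * (3 + b) + r ]₃        ≡⟨ cong [_]₃ (value-3+b r a b) ⟩
    [ 3 + (3 + (a + 2 * b + r)) ]₃  ≡⟨ [3+n]₃≡[n]₃ (3 + (a + 2 * b + r)) ⟩
    [ 3 + (a + 2 * b + r) ]₃        ≡⟨ [3+n]₃≡[n]₃ (a + 2 * b + r) ⟩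
    [ a + 2 * b + r ]₃              ∎)
  (trans (cong [_]₃ (pieces-3+b a b)) ([3+n]₃≡[n]₃ (a + b)))
  where
  value-3+b : ∀ r a b → a + 2 * (3 + b) + r ≡ 3 + (3 + (a + 2 * b + r))
  value-3+b = solve-∀
  pieces-3+b : ∀ a b → a + (3 + b) ≡ 3 + (a + b)
  pieces-3+b = solve-∀

emptyF₁⇒excess≢2 : ∀ b → excess (pos 0 0 b) ≢ 2₃
emptyF₁⇒excess≢2 0 ()
emptyF₁⇒excess≢2 1 ()
emptyF₁⇒excess≢2 2 ()
emptyF₁⇒excess≢2 (suc (suc (suc b))) = emptyF₁⇒excess≢2 b ∘ trans (sym (excess-3+b 0 0 b))

emptyF₂⇒excess≢2 : ∀ a → excess (pos 0 a 0) ≢ 2₃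
emptyF₂⇒excess≢2 0 ()
emptyF₂⇒excess≢2 1 ()
emptyF₂⇒excess≢2 2 ()
emptyF₂⇒excess≢2 (suc (suc (suc a))) = emptyF₂⇒excess≢2 a ∘ trans (sym (excess-3+a 0 a 0))

reducedLost : ℕ → ℤ₃ → Bool
reducedLost zero 0₃ = true
reducedLost zero 1₃ = false
reducedLost zero 2₃ = false
reducedLost (suc zero) g = not (reducedLost zero (suc₃ g))
reducedLost (suc (suc r)) g = not (reducedLost (suc r) (suc₃ g) ∨ reducedLost r (suc₃ g))

reducedLost-place₁ : ∀ r g → reducedLost (suc r) g ≡ true → reducedLost r (suc₃ g) ≡ false
reducedLost-place₁ zero g h = not-injective h
reducedLost-place₁ (suc r) g h = ∨-conicalˡ _ _ (not-injective h)

reducedLost-place₂ : ∀ r g → reducedLost (suc (suc r)) g ≡ true → reducedLost r (suc₃ g) ≡ false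
reducedLost-place₂ r g h = ∨-conicalʳ _ _ (not-injective h)

reducedLost-remove₁ : ∀ g → reducedLost 0 (suc₃ g) ≡ true → reducedLost 0 g ≡ false
reducedLost-remove₁ 0₃ ()
reducedLost-remove₁ 1₃ ()
reducedLost-remove₁ 2₃ _ = refl

reducedLost-remove₂ : ∀ g → reducedLost 0 (suc₃ (suc₃ g)) ≡ true → reducedLost 0 g ≡ false
reducedLost-remove₂ 0₃ ()
reducedLost-remove₂ 1₃ _ = refl
reducedLost-remove₂ 2₃ ()

reducedLost-periodic : ∀ r g → reducedLost (9 + r) g ≡ reducedLost r g
reducedLost-periodic 0 0₃ = refl
reducedLost-periodic 0 1₃ = refl
reducedLost-periodic 0 2₃ = refl
reducedLost-periodic 1 0₃ = refl
reducedLost-periodic 1 1₃ = refl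
reducedLost-periodic 1 2₃ = refl
reducedLost-periodic (suc (suc r)) g =
  cong₂ (λ x y → not (x ∨ y)) (reducedLost-periodic (suc r) (suc₃ g)) (reducedLost-periodic r (suc₃ g))

lost : Pos → Bool
lost p@(pos r _ _) = reducedLost r (excess p)

lost-trapped : ∀ {p q} → p ⇒ q → lost p ≡ true → lost q ≡ false
lost-trapped (put₁ {r} {a} {b}) h =
  subst (λ g → reducedLost r g ≡ false) (sym (excess-put₁ r a b)) (reducedLost-place₁ r _ h)
lost-trapped (put₂ {r} {a} {b}) h =
  subst (λ g → reducedLost r g ≡ false) (sym (excess-put₂ r a b)) (reducedLost-place₂ r _ h)
lost-trapped (add {a} {b}) h =
  reducedLost-remove₂ (excess (pos 0 a b)) (subst (λ g → reducedLost 0 g ≡ true) (excess-add a b) h)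
lost-trapped (merge {a} {b}) h =
  reducedLost-remove₁ (excess (pos 0 a (suc b))) (subst (λ g → reducedLost 0 g ≡ true) (excess-merge a b) h)
lost-trapped (split {a} {b}) h =
  reducedLost-remove₁ (excess (pos 0 (suc a) b)) (subst (λ g → reducedLost 0 g ≡ true) (excess-split a b) h)

excess≡0⇒lost : ∀ a b → excess (pos 0 a b) ≡ 0₃ → lost (pos 0 a b) ≡ true
excess≡0⇒lost a b = cong (reducedLost 0)

excess≡1⇒escape : ∀ a b → excess (pos 0 a b) ≡ 1₃ → ∃[ q ] pos 0 a b ⇒ q × lost q ≡ true
excess≡1⇒escape (suc (suc a)) b e =
  _ , merge , excess≡0⇒lost a (suc b) (suc₃-injective (trans (sym (excess-merge a b)) e))
excess≡1⇒escape a (suc (suc b)) e =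
  _ , split , excess≡0⇒lost (suc a) b (suc₃-injective (trans (sym (excess-split a b)) e))
excess≡1⇒escape 0 0 ()
excess≡1⇒escape 0 1 ()
excess≡1⇒escape 1 0 ()
excess≡1⇒escape 1 1 ()

excess≡2⇒escape : ∀ a b → excess (pos 0 a b) ≡ 2₃ → ∃[ q ] pos 0 a b ⇒ q × lost q ≡ true
excess≡2⇒escape (suc a) (suc b) e =
  _ , add , excess≡0⇒lost a b (suc₃-injective (suc₃-injective (trans (sym (excess-add a b)) e)))
excess≡2⇒escape zero b e = ⊥-elim (emptyF₁⇒excess≢2 b e)
excess≡2⇒escape a zero e = ⊥-elim (emptyF₂⇒excess≢2 a e)

lost-escape : ∀ {p} → lost p ≡ false → ∃[ q ] p ⇒ q × lost q ≡ true
lost-escape {pos zero a b} h with excess (pos 0 a b) in e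
lost-escape {pos zero a b} () | 0₃
... | 1₃ = excess≡1⇒escape a b e
... | 2₃ = excess≡2⇒escape a b e
lost-escape {pos (suc zero) a b} h =
  _ , put₁ , subst (λ g → reducedLost 0 g ≡ true) (sym (excess-put₁ 0 a b)) (not-injective h)
lost-escape {pos (suc (suc r)) a b} h
  with reducedLost (suc r) (suc₃ (excess (pos (suc (suc r)) a b))) in e
... | true =
  _ , put₁ , subst (λ g → reducedLost (suc r) g ≡ true) (sym (excess-put₁ (suc r) a b)) e
... | false =
  _ , put₂ , subst (λ g → reducedLost r g ≡ true) (sym (excess-put₂ r a b)) (not-injective h)

open Outcomes lost lost-trapped lost-escape

periodic⇒f[n]≡f[n%d] : ∀ {A : Set} (d : ℕ) .{{_ : NonZero d}} (f : ℕ → A) →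
                        (∀ n → f (d + n) ≡ f n) → ∀ n → f n ≡ f (n % d)
periodic⇒f[n]≡f[n%d] d f f-periodic n = begin
  f n                      ≡⟨ cong f (trans (m≡m%n+[m/n]*n n d) (+-comm (n % d) _)) ⟩
  f (n / d * d + n % d)    ≡⟨ multiples (n / d) ⟩
  f (n % d)                ∎
  where
  multiples : ∀ q → f (q * d + n % d) ≡ f (n % d)
  multiples zero = refl
  multiples (suc q) = trans (cong f (+-assoc d (q * d) (n % d))) (trans (f-periodic _) (multiples q))

lost-start-periodic : ∀ n → lost (start (9 + n)) ≡ lost (start n)
lost-start-periodic n = trans
  (cong (λ v → reducedLost (9 + n) (surplus v 0₃))
    (trans ([3+n]₃≡[n]₃ (6 + n)) (trans ([3+n]₃≡[n]₃ (3 + n)) ([3+n]₃≡[n]₃ n))))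
  (reducedLost-periodic n (surplus [ n ]₃ 0₃))

theorem4p8 : (n : ℕ) → 0 < n →
    ((n % 9 ≡ 1 ⊎ n % 9 ≡ 2 ⊎ n % 9 ≡ 3 ⊎ n % 9 ≡ 6 ⊎ n % 9 ≡ 8) → Win (start n))
    × ((n % 9 ≡ 0 ⊎ n % 9 ≡ 4 ⊎ n % 9 ≡ 5 ⊎ n % 9 ≡ 7) → Lose (start n))
theorem4p8 n _ =
    (λ { (inj₁ e) → winning e refl
       ; (inj₂ (inj₁ e)) → winning e refl
       ; (inj₂ (inj₂ (inj₁ e))) → winning e refl
       ; (inj₂ (inj₂ (inj₂ (inj₁ e)))) → winning e refl
       ; (inj₂ (inj₂ (inj₂ (inj₂ e)))) → winning e refl })
  , (λ { (inj₁ e) → losing e refl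
       ; (inj₂ (inj₁ e)) → losing e refl
       ; (inj₂ (inj₂ (inj₁ e))) → losing e refl
       ; (inj₂ (inj₂ (inj₂ e))) → losing e refl })
  where
  lost-start : ∀ {m} → n % 9 ≡ m → lost (start n) ≡ lost (start m)
  lost-start e =
    trans (periodic⇒f[n]≡f[n%d] 9 (lost ∘ start) lost-start-periodic n) (cong (lost ∘ start) e)
  winning : ∀ {m} → n % 9 ≡ m → lost (start m) ≡ false → Win (start n)
  winning e h = ¬lost⇒Win (start n) (trans (lost-start e) h)
  losing : ∀ {m} → n % 9 ≡ m → lost (start m) ≡ true → Lose (start n)
  losing e h = lost⇒Lose (start n) (trans (lost-start e) h)
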